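{- Let $\prec'$ be the transitive closure on $\mathbb{Z}^3$ of the relation $\mathbf{v}\lessdot'\mathbf{w}\iff \mathbf{v}-\mathbf{w}\in X_3$ (for $\mathbf v,\mathbf w\in\mathbb{Z}^3$). Then for all $\mathbf{v},\mathbf{w}\in\Lambda_3$, $\mathbf{v}\prec\mathbf{w}$ if and only if $\mathbf{v}\prec'\mathbf{w}$; that is, $\prec$ is the restriction of $\prec'$ to $\Lambda_3$.
   Context: $\Lambda_3=\mathbb{Z}_{\geq0}^3$; $X_3=\{(1,-2,0),(-2,1,0),(-1,-1,1),(0,0,-1)\}$. For $\mathbf{v},\mathbf{w}\in\Lambda_3$, $\mathbf{v}\lessdot\mathbf{w}$ iff $\mathbf{v}-\mathbf{w}\in X_3$, and $\prec$ is the transitive closure of $\lessdot$ on $\Lambda_3$ (i.e., via chains all of whose members lie in $\Lambda_3$). -}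

module Defs where

open import Data.Nat using (ℕ)
open import Data.Integer using (ℤ; +_; -[1+_]; _-_)
open import Data.Product using (_×_; _,_)
open import Relation.Binary.PropositionalEquality using (_≡_)
open import Relation.Binary.Construct.Closure.Transitive using (TransClosure)

-- ℤ³ and Λ₃ = ℤ_{≥0}³ (represented as ℕ³)
ℤ³ : Set
ℤ³ = ℤ × ℤ × ℤ

Λ₃ : Set
Λ₃ = ℕ × ℕ × ℕ

ι : Λ₃ → ℤ³
ι (a , b , c) = (+ a , + b , + c)

_−³_ : ℤ³ → ℤ³ → ℤ³
(a , b , c) −³ (a' , b' , c') = (a - a' , b - b' , c - c')

data X₃ : ℤ³ → Set where
  x₁ : X₃ (+ 1 , -[1+ 1 ] , + 0)
  x₂ : X₃ (-[1+ 1 ] , + 1 , + 0)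
  x₃ : X₃ (-[1+ 0 ] , -[1+ 0 ] , + 1)
  x₄ : X₃ (+ 0 , + 0 , -[1+ 0 ])

_⋖'_ : ℤ³ → ℤ³ → Set
v ⋖' w = X₃ (v −³ w)

_⋖_ : Λ₃ → Λ₃ → Set
v ⋖ w = X₃ (ι v −³ ι w)

-- ≺ : transitive closure of ⋖ within Λ₃ (chains stay in Λ₃)
_≺_ : Λ₃ → Λ₃ → Set
_≺_ = TransClosure _⋖_

_≺'_ : ℤ³ → ℤ³ → Set
_≺'_ = TransClosure _⋖'_

-- v ≺' w means v − w = p x₁ + q x₂ + r x₃ + s x₄ with p, q, r, s ∈ ℕ not all zero. For
-- v, w ∈ Λ₃ such a combination is realised inside Λ₃ one generator at a time, by induction on
-- p + q + r + s: at w = (a, b, c) some generator with positive count keeps the point in Λ₃, as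
-- v ∈ Λ₃ bounds the counts by the coordinates of w (adding the first two coordinates of v gives
-- a + b ≥ p + q + 2r). The one case where no generator fits is p, q > 0 with a = b = 1; there
-- x₁ + x₂ = x₃ + x₄ allows a step along x₃ instead.
module Submission where

open import Defs

open import Data.Nat using (ℕ; zero; suc; _≤_; _<_; s≤s; z≤n)
  renaming (_+_ to _+ℕ_)
import Data.Nat.Properties as ℕ
open import Data.Integer using (ℤ; +_; _+_; _-_)
import Data.Integer.Properties as ℤ
open import Data.Product using (_×_; Σ-syntax; _,_; proj₁; proj₂)
open import Data.Empty using (⊥-elim)
open import Function using (_∘_)
open import Relation.Binary.PropositionalEquality
  using (_≡_; refl; sym; trans; cong; cong₂; subst; subst₂; module ≡-Reasoning)
open import Relation.Binary.Construct.Closure.Transitive using ([_]; _∷_; _∷ʳ_)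
import Data.Nat.Tactic.RingSolver as ℕ-Solver
import Data.Integer.Tactic.RingSolver as ℤ-Solver

open ≡-Reasoning

infixl 6 _+³_

_+³_ : ℤ³ → ℤ³ → ℤ³
(a , b , c) +³ (a' , b' , c') = (a + a' , b + b' , c + c')

≡,≡,≡→≡ : ∀ {a b c a' b' c' : ℤ} → a ≡ a' → b ≡ b' → c ≡ c' → (a , b , c) ≡ (a' , b' , c')
≡,≡,≡→≡ refl refl refl = refl

+³-assoc : ∀ u v w → (u +³ v) +³ w ≡ u +³ (v +³ w)
+³-assoc (a , b , c) (a' , b' , c') (a'' , b'' , c'') =
  ≡,≡,≡→≡ (ℤ.+-assoc a a' a'') (ℤ.+-assoc b b' b'') (ℤ.+-assoc c c' c'')

+³-comm : ∀ u v → u +³ v ≡ v +³ u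
+³-comm (a , b , c) (a' , b' , c') = ≡,≡,≡→≡ (ℤ.+-comm a a') (ℤ.+-comm b b') (ℤ.+-comm c c')

−³-+³-cancel : ∀ u v → (u −³ v) +³ v ≡ u
−³-+³-cancel (a , b , c) (a' , b' , c') = ≡,≡,≡→≡ (cancel a a') (cancel b b') (cancel c c')
  where
  cancel : ∀ (x y : ℤ) → x - y + y ≡ x
  cancel = ℤ-Solver.solve-∀

+³-−³-cancel : ∀ u v → (u +³ v) −³ v ≡ u
+³-−³-cancel (a , b , c) (a' , b' , c') = ≡,≡,≡→≡ (cancel a a') (cancel b b') (cancel c c')
  where
  cancel : ∀ (x y : ℤ) → x + y - y ≡ x
  cancel = ℤ-Solver.solve-∀

Counts : Set
Counts = ℕ × ℕ × ℕ × ℕ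

size : Counts → ℕ
size (p , q , r , s) = p +ℕ q +ℕ r +ℕ s

_⊕_ : Counts → Counts → Counts
(p , q , r , s) ⊕ (p' , q' , r' , s') = (p +ℕ p' , q +ℕ q' , r +ℕ r' , s +ℕ s')

-- p x₁ + q x₂ + r x₃ + s x₄
combination : Counts → ℤ³
combination (p , q , r , s) = (+ p - + (r +ℕ (q +ℕ q)) , + q - + (r +ℕ (p +ℕ p)) , + r - + s)

size-⊕ : ∀ m n → size (m ⊕ n) ≡ size m +ℕ size n
size-⊕ (p , q , r , s) (p' , q' , r' , s') = regroup p q r s p' q' r' s'
  where
  regroup : ∀ p q r s p' q' r' s' →
            p +ℕ p' +ℕ (q +ℕ q') +ℕ (r +ℕ r') +ℕ (s +ℕ s') ≡ p +ℕ q +ℕ r +ℕ s +ℕ (p' +ℕ q' +ℕ r' +ℕ s')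
  regroup = ℕ-Solver.solve-∀

combination-⊕ : ∀ m n → combination (m ⊕ n) ≡ combination m +³ combination n
combination-⊕ (p , q , r , s) (p' , q' , r' , s') =
  ≡,≡,≡→≡ (mixed (+ p) (+ q) (+ r) (+ p') (+ q') (+ r')) (mixed (+ q) (+ p) (+ r) (+ q') (+ p') (+ r'))
          (plain (+ r) (+ s) (+ r') (+ s'))
  where
  mixed : ∀ (p q r p' q' r' : ℤ) →
          p + p' - (r + r' + (q + q' + (q + q'))) ≡ p - (r + (q + q)) + (p' - (r' + (q' + q')))
  mixed = ℤ-Solver.solve-∀
  plain : ∀ (r s r' s' : ℤ) → r + r' - (s + s') ≡ r - s + (r' - s')
  plain = ℤ-Solver.solve-∀

count : ∀ {x} → X₃ x → Counts
count x₁ = (1 , 0 , 0 , 0)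
count x₂ = (0 , 1 , 0 , 0)
count x₃ = (0 , 0 , 1 , 0)
count x₄ = (0 , 0 , 0 , 1)

combination-count : ∀ {x} (x∈X₃ : X₃ x) → combination (count x∈X₃) ≡ x
combination-count x₁ = refl
combination-count x₂ = refl
combination-count x₃ = refl
combination-count x₄ = refl

size-count : ∀ {x} (x∈X₃ : X₃ x) → size (count x∈X₃) ≡ 1
size-count x₁ = refl
size-count x₂ = refl
size-count x₃ = refl
size-count x₄ = refl

⋖'⇒combination : ∀ {u t} (u⋖'t : u ⋖' t) → u ≡ combination (count u⋖'t) +³ t
⋖'⇒combination {u} {t} u⋖'t = begin
  u                                  ≡⟨ sym (−³-+³-cancel u t) ⟩
  (u −³ t) +³ t                      ≡⟨ cong (_+³ t) (sym (combination-count u⋖'t)) ⟩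
  combination (count u⋖'t) +³ t      ∎

combination-trans : ∀ {u s t} m n → u ≡ combination m +³ s → s ≡ combination n +³ t →
                    u ≡ combination (m ⊕ n) +³ t
combination-trans {u} {s} {t} m n u≡ s≡ = begin
  u                                        ≡⟨ u≡ ⟩
  combination m +³ s                       ≡⟨ cong (combination m +³_) s≡ ⟩
  combination m +³ (combination n +³ t)    ≡⟨ sym (+³-assoc (combination m) (combination n) t) ⟩
  combination m +³ combination n +³ t      ≡⟨ cong (_+³ t) (sym (combination-⊕ m n)) ⟩
  combination (m ⊕ n) +³ t                 ∎

≺'⇒combination : ∀ {u t} → u ≺' t →
                 Σ[ n ∈ Counts ] Σ[ k ∈ ℕ ] size n ≡ suc k × u ≡ combination n +³ t
≺'⇒combination [ u⋖'t ] = count u⋖'t , 0 , size-count u⋖'t , ⋖'⇒combination u⋖'t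
≺'⇒combination (u⋖'s ∷ s≺'t) with ≺'⇒combination s≺'t
... | n , k , size-n , s≡ =
  count u⋖'s ⊕ n , suc k , trans (size-⊕ (count u⋖'s) n) (cong₂ _+ℕ_ (size-count u⋖'s) size-n) ,
  combination-trans (count u⋖'s) n (⋖'⇒combination u⋖'s) s≡

-- w + combination n ∈ Λ₃, with subtraction cleared; summands are ordered so that the
-- infeasible cases of `move` are refuted by absurd patterns.
data Feasible : Λ₃ → Counts → Set where
  bounds : ∀ {a b c p q r s} →
           r +ℕ (q +ℕ q) ≤ p +ℕ a → r +ℕ (p +ℕ p) ≤ q +ℕ b → s ≤ r +ℕ c →
           Feasible (a , b , c) (p , q , r , s)

+v≡m-n+a⇒n≤m+a : ∀ {v m n a} → + v ≡ + m - + n + + a → n ≤ m +ℕ a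
+v≡m-n+a⇒n≤m+a {v} {m} {n} {a} v≡ = subst (n ≤_) (ℤ.+-injective v+n≡m+a) (ℕ.m≤n+m n v)
  where
  rearrange : ∀ (m n a : ℤ) → m - n + a + n ≡ m + a
  rearrange = ℤ-Solver.solve-∀
  v+n≡m+a : + (v +ℕ n) ≡ + (m +ℕ a)
  v+n≡m+a = trans (cong (_+ + n) v≡) (rearrange (+ m) (+ n) (+ a))

combination⇒Feasible : ∀ {v w n} → ι v ≡ combination n +³ ι w → Feasible w n
combination⇒Feasible {_ , _ , _} {_ , _ , _} {_ , _ , _ , _} v≡ = bounds
  (+v≡m-n+a⇒n≤m+a (cong proj₁ v≡))
  (+v≡m-n+a⇒n≤m+a (cong (proj₁ ∘ proj₂) v≡))
  (+v≡m-n+a⇒n≤m+a (cong (proj₂ ∘ proj₂) v≡))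

Feasible⇒sum-bound : ∀ {a b c p q r s} → Feasible (a , b , c) (p , q , r , s) →
                     r +ℕ r +ℕ (p +ℕ q) ≤ a +ℕ b
Feasible⇒sum-bound {a} {b} {_} {p} {q} {r} (bounds A B _) =
  ℕ.+-cancelʳ-≤ (p +ℕ q) _ _ (subst₂ _≤_ (lhs r p q) (rhs a b p q) (ℕ.+-mono-≤ A B))
  where
  lhs : ∀ r p q → r +ℕ (q +ℕ q) +ℕ (r +ℕ (p +ℕ p)) ≡ r +ℕ r +ℕ (p +ℕ q) +ℕ (p +ℕ q)
  lhs = ℕ-Solver.solve-∀
  rhs : ∀ a b p q → p +ℕ a +ℕ (q +ℕ b) ≡ a +ℕ b +ℕ (p +ℕ q)
  rhs = ℕ-Solver.solve-∀

record Move (w : Λ₃) (n : Counts) : Set where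
  field
    w′ : Λ₃
    n′ : Counts
    w′⋖w : w′ ⋖ w
    size-n′ : suc (size n′) ≡ size n
    invariant : combination n +³ ι w ≡ combination n′ +³ ι w′

along : ∀ {w n x} w′ n′ → X₃ x → ι w′ ≡ x +³ ι w →
        combination n ≡ x +³ combination n′ → suc (size n′) ≡ size n → Move w n
along {w} {n} {x} w′ n′ x∈X₃ w′≡ n≡ size-n′ = record
  { w′ = w′
  ; n′ = n′
  ; w′⋖w = subst X₃ (sym w′−w≡x) x∈X₃
  ; size-n′ = size-n′
  ; invariant = begin
      combination n +³ ι w                  ≡⟨ cong (_+³ ι w) n≡ ⟩
      x +³ combination n′ +³ ι w            ≡⟨ cong (_+³ ι w) (+³-comm x (combination n′)) ⟩
      combination n′ +³ x +³ ι w            ≡⟨ +³-assoc (combination n′) x (ι w) ⟩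
      combination n′ +³ (x +³ ι w)          ≡⟨ cong (combination n′ +³_) (sym w′≡) ⟩
      combination n′ +³ ι w′                ∎
  }
  where
  w′−w≡x : ι w′ −³ ι w ≡ x
  w′−w≡x = trans (cong (_−³ ι w) w′≡) (+³-−³-cancel x (ι w))

peel : ∀ {w x} w′ n′ (x∈X₃ : X₃ x) → ι w′ ≡ x +³ ι w → Move w (count x∈X₃ ⊕ n′)
peel {x = x} w′ n′ x∈X₃ w′≡ = along w′ n′ x∈X₃ w′≡ combination≡ size≡
  where
  combination≡ : combination (count x∈X₃ ⊕ n′) ≡ x +³ combination n′
  combination≡ = trans (combination-⊕ (count x∈X₃) n′)
                       (cong (_+³ combination n′) (combination-count x∈X₃))
  size≡ : suc (size n′) ≡ size (count x∈X₃ ⊕ n′)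
  size≡ = trans (cong (_+ℕ size n′) (sym (size-count x∈X₃))) (sym (size-⊕ (count x∈X₃) n′))

-- The ≡⟨⟩ step below is the relation x₁ + x₂ = x₃ + x₄, which holds by computation.
exchange : ∀ {a b c} p q r s → Move (suc a , suc b , c) (suc p , suc q , r , s)
exchange {a} {b} {c} p q r s =
  along (a , b , suc c) ((0 , 0 , 0 , 1) ⊕ m) x₃ refl combination≡ size≡
  where
  m : Counts
  m = (p , q , r , s)
  combination≡ : combination ((1 , 1 , 0 , 0) ⊕ m) ≡
                 combination (0 , 0 , 1 , 0) +³ combination ((0 , 0 , 0 , 1) ⊕ m)
  combination≡ = begin
    combination ((1 , 1 , 0 , 0) ⊕ m)
      ≡⟨ combination-⊕ (1 , 1 , 0 , 0) m ⟩
    combination (1 , 1 , 0 , 0) +³ combination m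
      ≡⟨⟩
    combination (0 , 0 , 1 , 0) +³ combination (0 , 0 , 0 , 1) +³ combination m
      ≡⟨ +³-assoc (combination (0 , 0 , 1 , 0)) (combination (0 , 0 , 0 , 1)) (combination m) ⟩
    combination (0 , 0 , 1 , 0) +³ (combination (0 , 0 , 0 , 1) +³ combination m)
      ≡⟨ cong (combination (0 , 0 , 1 , 0) +³_) (sym (combination-⊕ (0 , 0 , 0 , 1) m)) ⟩
    combination (0 , 0 , 1 , 0) +³ combination ((0 , 0 , 0 , 1) ⊕ m)
      ∎
  size≡ : suc (size ((0 , 0 , 0 , 1) ⊕ m)) ≡ size ((1 , 1 , 0 , 0) ⊕ m)
  size≡ = trans (cong suc (size-⊕ (0 , 0 , 0 , 1) m)) (sym (size-⊕ (1 , 1 , 0 , 0) m))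

1<suc+suc : ∀ m n → 1 < suc m +ℕ suc n
1<suc+suc m n = s≤s (ℕ.≤-trans (s≤s z≤n) (ℕ.m≤n+m (suc n) m))

r>0⇒1<a+b : ∀ {a b c p q r s} → Feasible (a , b , c) (p , q , suc r , s) → 1 < a +ℕ b
r>0⇒1<a+b {p = p} {q} {r} f =
  ℕ.≤-trans (1<suc+suc r r) (ℕ.≤-trans (ℕ.m≤m+n (suc r +ℕ suc r) (p +ℕ q)) (Feasible⇒sum-bound f))

p,q>0⇒1<a+b : ∀ {a b c p q r s} → Feasible (a , b , c) (suc p , suc q , r , s) → 1 < a +ℕ b
p,q>0⇒1<a+b {p = p} {q} {r} f =
  ℕ.≤-trans (1<suc+suc p q) (ℕ.≤-trans (ℕ.m≤n+m (suc p +ℕ suc q) (r +ℕ r)) (Feasible⇒sum-bound f))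

move : ∀ {k} w n → size n ≡ suc k → Feasible w n → Move w n
move (a , b , suc c) (p , q , r , suc s) _ _ = peel (a , b , c) (p , q , r , s) x₄ refl
move (suc a , suc b , c) (p , q , suc r , s) _ _ = peel (a , b , suc c) (p , q , r , s) x₃ refl
move (a , suc (suc b) , c) (suc p , q , r , s) _ _ = peel (suc a , b , c) (p , q , r , s) x₁ refl
move (suc (suc a) , b , c) (p , suc q , r , s) _ _ = peel (a , suc b , c) (p , q , r , s) x₂ refl
move (suc a , suc b , c) (suc p , suc q , r , s) _ _ = exchange p q r s
move (_ , _ , _) (zero , zero , zero , zero) () _
move (_ , _ , zero) (_ , _ , zero , suc _) _ (bounds _ _ ())
move (zero , suc (suc _) , _) (zero , _ , suc _ , _) _ (bounds () _ _)
move (suc (suc _) , zero , _) (_ , zero , suc _ , _) _ (bounds _ () _)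
move (zero , zero , _) (_ , _ , suc _ , _) _ f = ⊥-elim (ℕ.<⇒≱ (r>0⇒1<a+b f) z≤n)
move (zero , suc zero , _) (_ , _ , suc _ , _) _ f = ⊥-elim (ℕ.<⇒≱ (r>0⇒1<a+b f) ℕ.≤-refl)
move (suc zero , zero , _) (_ , _ , suc _ , _) _ f = ⊥-elim (ℕ.<⇒≱ (r>0⇒1<a+b f) ℕ.≤-refl)
move (zero , zero , _) (suc _ , suc _ , zero , zero) _ f = ⊥-elim (ℕ.<⇒≱ (p,q>0⇒1<a+b f) z≤n)
move (zero , suc zero , _) (suc _ , suc _ , zero , zero) _ f = ⊥-elim (ℕ.<⇒≱ (p,q>0⇒1<a+b f) ℕ.≤-refl)
move (suc zero , zero , _) (suc _ , suc _ , zero , zero) _ f = ⊥-elim (ℕ.<⇒≱ (p,q>0⇒1<a+b f) ℕ.≤-refl)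
move (_ , zero , _) (suc _ , zero , zero , zero) _ (bounds _ () _)
move (_ , suc zero , _) (suc p , zero , zero , zero) _ (bounds _ B _) = ⊥-elim (ℕ.<⇒≱ (1<suc+suc p p) B)
move (zero , _ , _) (zero , suc _ , zero , zero) _ (bounds () _ _)
move (suc zero , _ , _) (zero , suc q , zero , zero) _ (bounds A _ _) = ⊥-elim (ℕ.<⇒≱ (1<suc+suc q q) A)

ι-injective : ∀ {v w} → ι v ≡ ι w → v ≡ w
ι-injective {_ , _ , _} {_ , _ , _} refl = refl

size≡0⇒≡ : ∀ {v w} n → size n ≡ 0 → ι v ≡ combination n +³ ι w → v ≡ w
size≡0⇒≡ {w = _ , _ , _} (zero , zero , zero , zero) refl v≡ = ι-injective v≡

combination⇒≺ : ∀ k {v w} n → size n ≡ suc k → ι v ≡ combination n +³ ι w → v ≺ w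
combination⇒≺ k {v} {w} n size-n v≡ =
  continue k (ℕ.suc-injective (trans size-n′ size-n)) (trans v≡ invariant)
  where
  open Move (move w n size-n (combination⇒Feasible v≡))
  continue : ∀ j → size n′ ≡ j → ι v ≡ combination n′ +³ ι w′ → v ≺ w
  continue zero    size≡ v≡′ = subst (_≺ w) (sym (size≡0⇒≡ n′ size≡ v≡′)) [ w′⋖w ]
  continue (suc j) size≡ v≡′ = combination⇒≺ j n′ size≡ v≡′ ∷ʳ w′⋖w

≺⇒≺' : ∀ {v w} → v ≺ w → ι v ≺' ι w
≺⇒≺' [ v⋖w ] = [ v⋖w ]
≺⇒≺' (v⋖u ∷ u≺w) = v⋖u ∷ ≺⇒≺' u≺w

≺'⇒≺ : ∀ {v w} → ι v ≺' ι w → v ≺ w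
≺'⇒≺ v≺'w with ≺'⇒combination v≺'w
... | n , k , size-n , v≡ = combination⇒≺ k n size-n v≡

proposition3p1 : (v w : Λ₃) → (v ≺ w → ι v ≺' ι w) × (ι v ≺' ι w → v ≺ w)
proposition3p1 v w = ≺⇒≺' , ≺'⇒≺
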